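{- Let $\mathbf{G}=(\mathbf{A},\forall,\exists)$ be a monadic Gödel algebra and $\mathbf{K}(\mathbf{G})$ its associated monadic $N_c$-algebra. Then the map $f:Con(\mathbf{G})\to Con(\mathbf{K}(\mathbf{G}))$, $f(\theta)=\gamma_\theta$, where $(a,b)\,\gamma_\theta\,(x,y)$ iff $(a,x)\in\theta$ and $(b,y)\in\theta$, is an order isomorphism.
   Context: $Con(\mathbf{B})$ denotes the lattice of congruences of an algebra $\mathbf{B}$, ordered by inclusion. A Heyting algebra is $\langle A,\vee,\wedge,\Rightarrow,0,1\rangle$ with bounded lattice reduct satisfying $x\wedge(x\Rightarrow y)=x\wedge y$, $x\wedge(y\Rightarrow z)=x\wedge((x\wedge y)\Rightarrow(x\wedge z))$, $(x\wedge y)\Rightarrow x=1$. A monadic Heyting algebra is $(\mathbf{A},\forall,\exists)$ with unary operations satisfying $\forall x\leq x$, $x\leq\exists x$, $\forall(x\wedge y)=\forall x\wedge\forall y$, $\exists(x\vee y)=\exists x\vee\exists y$, $\forall 1=1$, $\exists 0=0$, $\forall\exists x=\exists x$, $\exists\forall x=\forall x$, $\forall(x\Rightarrow y)\leq\exists x\Rightarrow\exists y$. A monadic Gödel algebra is a monadic Heyting algebra satisfying $(x\Rightarrow y)\vee(y\Rightarrow x)=1$ and $\forall(\exists x\vee y)=\exists x\vee\forall y$; its congruences are those compatible with $\vee,\wedge,\Rightarrow,\forall,\exists$. $\mathbf{K}(\mathbf{G})$ is the algebra on $K(A)=\{(a,b)\in A\times A:a\wedge b=0\}$ with $(a,b)\vee(d,e)=(a\vee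 d,b\wedge e)$, $(a,b)\wedge(d,e)=(a\wedge d,b\vee e)$, $(a,b)\to(d,e)=(a\Rightarrow d,a\wedge e)$, $\sim(a,b)=(b,a)$, constants $0=(0,1)$, $1=(1,0)$, and $\exists_K(a,b)=(\exists a,\forall b)$; its congruences are those compatible with $\vee,\wedge,\to,\sim,\exists_K$. -}

module Defs where

open import Level using (Level; _⊔_; suc)
open import Data.Product using (Σ; _×_; _,_; proj₁; proj₂)
open import Relation.Binary.PropositionalEquality using (_≡_)
open import Relation.Binary.Structures using (IsEquivalence)

record MonadicGodelAlgebra (a : Level) : Set (suc a) where
  infixr 5 _⇒_
  infixr 6 _∨_
  infixr 7 _∧_
  field
    Carrier : Set a
    _∨_ _∧_ _⇒_ : Carrier → Carrier → Carrier
    𝟎 𝟏 : Carrier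
    ∀′ ∃′ : Carrier → Carrier

  _≤_ : Carrier → Carrier → Set a
  x ≤ y = x ∧ y ≡ x

  field
    ∨-assoc : ∀ x y z → (x ∨ y) ∨ z ≡ x ∨ (y ∨ z)
    ∧-assoc : ∀ x y z → (x ∧ y) ∧ z ≡ x ∧ (y ∧ z)
    ∨-comm : ∀ x y → x ∨ y ≡ y ∨ x
    ∧-comm : ∀ x y → x ∧ y ≡ y ∧ x
    ∨-absorbs-∧ : ∀ x y → x ∨ (x ∧ y) ≡ x
    ∧-absorbs-∨ : ∀ x y → x ∧ (x ∨ y) ≡ x
    ∧-zero : ∀ x → x ∧ 𝟎 ≡ 𝟎
    ∨-one : ∀ x → x ∨ 𝟏 ≡ 𝟏
    H1 : ∀ x y → x ∧ (x ⇒ y) ≡ x ∧ y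
    H2 : ∀ x y z → x ∧ (y ⇒ z) ≡ x ∧ ((x ∧ y) ⇒ (x ∧ z))
    H3 : ∀ x y → (x ∧ y) ⇒ x ≡ 𝟏
    M1 : ∀ x → ∀′ x ≤ x
    M2 : ∀ x → x ≤ ∃′ x
    M3 : ∀ x y → ∀′ (x ∧ y) ≡ ∀′ x ∧ ∀′ y
    M4 : ∀ x y → ∃′ (x ∨ y) ≡ ∃′ x ∨ ∃′ y
    M5 : ∀′ 𝟏 ≡ 𝟏
    M6 : ∃′ 𝟎 ≡ 𝟎
    M7 : ∀ x → ∀′ (∃′ x) ≡ ∃′ x
    M8 : ∀ x → ∃′ (∀′ x) ≡ ∀′ x
    M9 : ∀ x y → ∀′ (x ⇒ y) ≤ (∃′ x ⇒ ∃′ y)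
    prelinearity : ∀ x y → (x ⇒ y) ∨ (y ⇒ x) ≡ 𝟏
    G-monadic : ∀ x y → ∀′ (∃′ x ∨ y) ≡ ∃′ x ∨ ∀′ y

module _ {a : Level} (G : MonadicGodelAlgebra a) where
  open MonadicGodelAlgebra G

  record IsCongruenceG {ℓ : Level} (θ : Carrier → Carrier → Set ℓ) : Set (a ⊔ ℓ) where
    field
      isEquivalence : IsEquivalence θ
      ∨-cong : ∀ {x x′ y y′} → θ x x′ → θ y y′ → θ (x ∨ y) (x′ ∨ y′)
      ∧-cong : ∀ {x x′ y y′} → θ x x′ → θ y y′ → θ (x ∧ y) (x′ ∧ y′)
      ⇒-cong : ∀ {x x′ y y′} → θ x x′ → θ y y′ → θ (x ⇒ y) (x′ ⇒ y′)
      ∀-cong : ∀ {x x′} → θ x x′ → θ (∀′ x) (∀′ x′)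
      ∃-cong : ∀ {x x′} → θ x x′ → θ (∃′ x) (∃′ x′)

  KCarrier : Set a
  KCarrier = Σ (Carrier × Carrier) (λ p → proj₁ p ∧ proj₂ p ≡ 𝟎)

  pair : KCarrier → Carrier × Carrier
  pair = proj₁

  _∨K_ : Carrier × Carrier → Carrier × Carrier → Carrier × Carrier
  (x , y) ∨K (d , e) = (x ∨ d , y ∧ e)

  _∧K_ : Carrier × Carrier → Carrier × Carrier → Carrier × Carrier
  (x , y) ∧K (d , e) = (x ∧ d , y ∨ e)

  _→K_ : Carrier × Carrier → Carrier × Carrier → Carrier × Carrier
  (x , y) →K (d , e) = (x ⇒ d , x ∧ e)

  ∼K : Carrier × Carrier → Carrier × Carrier
  ∼K (x , y) = (y , x)

  ∃K : Carrier × Carrier → Carrier × Carrier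
  ∃K (x , y) = (∃′ x , ∀′ y)

  -- Compatibility
  -- is phrased via the graph of each operation: whenever r, r′ ∈ K(A)
  -- are the results of applying the operation, they are related.
  record IsCongruenceK {ℓ : Level} (φ : KCarrier → KCarrier → Set ℓ) : Set (a ⊔ ℓ) where
    field
      isEquivalence : IsEquivalence φ
      ∨-cong : ∀ {p p′ q q′ r r′} → φ p p′ → φ q q′ →
               pair r ≡ pair p ∨K pair q → pair r′ ≡ pair p′ ∨K pair q′ → φ r r′
      ∧-cong : ∀ {p p′ q q′ r r′} → φ p p′ → φ q q′ →
               pair r ≡ pair p ∧K pair q → pair r′ ≡ pair p′ ∧K pair q′ → φ r r′
      →-cong : ∀ {p p′ q q′ r r′} → φ p p′ → φ q q′ →
               pair r ≡ pair p →K pair q → pair r′ ≡ pair p′ →K pair q′ → φ r r′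
      ∼-cong : ∀ {p p′ r r′} → φ p p′ →
               pair r ≡ ∼K (pair p) → pair r′ ≡ ∼K (pair p′) → φ r r′
      ∃-cong : ∀ {p p′ r r′} → φ p p′ →
               pair r ≡ ∃K (pair p) → pair r′ ≡ ∃K (pair p′) → φ r r′

  γ : {ℓ : Level} → (Carrier → Carrier → Set ℓ) → KCarrier → KCarrier → Set ℓ
  γ θ ((x , y) , _) ((x′ , y′) , _) = θ x x′ × θ y y′

_⊆₂_ : {a ℓ ℓ′ : Level} {X : Set a} → (X → X → Set ℓ) → (X → X → Set ℓ′) → Set (a ⊔ ℓ ⊔ ℓ′)
R ⊆₂ S = ∀ {x y} → R x y → S x y

_≐₂_ : {a ℓ ℓ′ : Level} {X : Set a} → (X → X → Set ℓ) → (X → X → Set ℓ′) → Set (a ⊔ ℓ ⊔ ℓ′)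
R ≐₂ S = (R ⊆₂ S) × (S ⊆₂ R)

-- Every element of K(G) is generated from "positive" elements (x, 0):
-- its coordinates are recovered as (a,b) ∨ (0,0) = (a,0) and ∼(a,b) ∨ (0,0) = (b,0),
-- and conversely (a,b) = (a,0) ∧ ((b,0) → (0,1)) because a ∧ b = 0.  Hence a
-- congruence φ of K(G) is determined by its restriction θ to positive elements,
-- which is a congruence of G (∀x is recovered as ∼∃∼(x,0)), and φ = γ_θ.
module Submission where

open import Defs
open import Level using (Level)
open import Data.Product using (Σ; _×_; _,_; proj₁)
open import Function.Bundles using (_⇔_; mk⇔)
open import Relation.Binary.PropositionalEquality
  using (_≡_; refl; sym; trans; cong; cong₂; module ≡-Reasoning)
open import Relation.Binary.Structures using (IsEquivalence)

module _ {a : Level} (G : MonadicGodelAlgebra a) where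
  open MonadicGodelAlgebra G
  open ≡-Reasoning

  ∨-identityʳ : ∀ x → x ∨ 𝟎 ≡ x
  ∨-identityʳ x = trans (cong (x ∨_) (sym (∧-zero x))) (∨-absorbs-∧ x 𝟎)

  ∨-identityˡ : ∀ x → 𝟎 ∨ x ≡ x
  ∨-identityˡ x = trans (∨-comm 𝟎 x) (∨-identityʳ x)

  ∧-identityʳ : ∀ x → x ∧ 𝟏 ≡ x
  ∧-identityʳ x = trans (cong (x ∧_) (sym (∨-one x))) (∧-absorbs-∨ x 𝟏)

  ∧-zeroˡ : ∀ x → 𝟎 ∧ x ≡ 𝟎
  ∧-zeroˡ x = trans (∧-comm 𝟎 x) (∧-zero x)

  ∧-idem : ∀ x → x ∧ x ≡ x
  ∧-idem x = trans (cong (x ∧_) (sym (∨-absorbs-∧ x x))) (∧-absorbs-∨ x (x ∧ x))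

  ⇒-refl : ∀ x → x ⇒ x ≡ 𝟏
  ⇒-refl x = trans (cong (_⇒ x) (sym (∧-idem x))) (H3 x x)

  ∧-¬-disjoint : ∀ {x y} → x ∧ y ≡ 𝟎 → x ∧ (y ⇒ 𝟎) ≡ x
  ∧-¬-disjoint {x} {y} x∧y≡𝟎 = begin
    x ∧ (y ⇒ 𝟎)              ≡⟨ H2 x y 𝟎 ⟩
    x ∧ ((x ∧ y) ⇒ (x ∧ 𝟎))  ≡⟨ cong₂ (λ u v → x ∧ (u ⇒ v)) x∧y≡𝟎 (∧-zero x) ⟩
    x ∧ (𝟎 ⇒ 𝟎)              ≡⟨ cong (x ∧_) (⇒-refl 𝟎) ⟩
    x ∧ 𝟏                    ≡⟨ ∧-identityʳ x ⟩
    x                        ∎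

  ∀-zero : ∀′ 𝟎 ≡ 𝟎
  ∀-zero = trans (sym (M1 𝟎)) (∧-zero (∀′ 𝟎))

  ⟨_,𝟎⟩ : Carrier → KCarrier G
  ⟨ x ,𝟎⟩ = (x , 𝟎) , ∧-zero x

  ⟨𝟎,_⟩ : Carrier → KCarrier G
  ⟨𝟎, x ⟩ = (𝟎 , x) , ∧-zeroˡ x

  ∼⟨_⟩ : ∀ {x y} → x ∧ y ≡ 𝟎 → KCarrier G
  ∼⟨_⟩ {x} {y} x∧y≡𝟎 = (y , x) , trans (∧-comm y x) x∧y≡𝟎

  ¬K⟨_,𝟎⟩ : Carrier → KCarrier G
  ¬K⟨ y ,𝟎⟩ = (y ⇒ 𝟎 , y) , trans (∧-comm (y ⇒ 𝟎) y) (trans (H1 y 𝟎) (∧-zero y))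

  ∨K-⟨𝟎,𝟎⟩ : ∀ x y → _∨K_ G (x , y) (𝟎 , 𝟎) ≡ (x , 𝟎)
  ∨K-⟨𝟎,𝟎⟩ x y = cong₂ _,_ (∨-identityʳ x) (∧-zero y)

  →K-⟨𝟎,𝟏⟩ : ∀ y → _→K_ G (y , 𝟎) (𝟎 , 𝟏) ≡ (y ⇒ 𝟎 , y)
  →K-⟨𝟎,𝟏⟩ y = cong (_ ,_) (∧-identityʳ y)

  K-decomposition : ∀ {x y} → x ∧ y ≡ 𝟎 → (x , y) ≡ _∧K_ G (x , 𝟎) (y ⇒ 𝟎 , y)
  K-decomposition {x} {y} x∧y≡𝟎 = sym (cong₂ _,_ (∧-¬-disjoint x∧y≡𝟎) (∨-identityˡ y))

  γ-intro : ∀ {ℓ} {θ : Carrier → Carrier → Set ℓ} (r r′ : KCarrier G) {x x′ y y′} →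
            pair G r ≡ (x , y) → pair G r′ ≡ (x′ , y′) →
            θ x x′ → θ y y′ → γ G θ r r′
  γ-intro _ _ refl refl θxx′ θyy′ = θxx′ , θyy′

  γ-isCongruenceK : ∀ {ℓ} (θ : Carrier → Carrier → Set ℓ) →
                    IsCongruenceG G θ → IsCongruenceK G (γ G θ)
  γ-isCongruenceK θ isCon = record
    { isEquivalence = record
      { refl  = E.refl , E.refl
      ; sym   = λ (p₁ , p₂) → E.sym p₁ , E.sym p₂
      ; trans = λ (p₁ , p₂) (q₁ , q₂) → E.trans p₁ q₁ , E.trans p₂ q₂
      }
    ; ∨-cong = λ {r = r} {r′ = r′} (p₁ , p₂) (q₁ , q₂) r≡ r′≡ →
        γ-intro r r′ r≡ r′≡ (C.∨-cong p₁ q₁) (C.∧-cong p₂ q₂)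
    ; ∧-cong = λ {r = r} {r′ = r′} (p₁ , p₂) (q₁ , q₂) r≡ r′≡ →
        γ-intro r r′ r≡ r′≡ (C.∧-cong p₁ q₁) (C.∨-cong p₂ q₂)
    ; →-cong = λ {r = r} {r′ = r′} (p₁ , _ ) (q₁ , q₂) r≡ r′≡ →
        γ-intro r r′ r≡ r′≡ (C.⇒-cong p₁ q₁) (C.∧-cong p₁ q₂)
    ; ∼-cong = λ {r = r} {r′ = r′} (p₁ , p₂) r≡ r′≡ →
        γ-intro r r′ r≡ r′≡ p₂ p₁
    ; ∃-cong = λ {r = r} {r′ = r′} (p₁ , p₂) r≡ r′≡ →
        γ-intro r r′ r≡ r′≡ (C.∃-cong p₁) (C.∀-cong p₂)
    }
    where
      module C = IsCongruenceG isCon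
      module E = IsEquivalence C.isEquivalence

  γ-⊆₂⇔ : ∀ {ℓ} (θ θ′ : Carrier → Carrier → Set ℓ) → IsCongruenceG G θ →
          (θ ⊆₂ θ′) ⇔ (γ G θ ⊆₂ γ G θ′)
  γ-⊆₂⇔ θ θ′ isCon = mk⇔ γ-mono γ-reflects
    where
      γ-mono : θ ⊆₂ θ′ → γ G θ ⊆₂ γ G θ′
      γ-mono θ⊆θ′ (p₁ , p₂) = θ⊆θ′ p₁ , θ⊆θ′ p₂

      γ-reflects : γ G θ ⊆₂ γ G θ′ → θ ⊆₂ θ′
      γ-reflects γθ⊆γθ′ {x} {y} θxy = proj₁ (γθ⊆γθ′ {⟨ x ,𝟎⟩} {⟨ y ,𝟎⟩} (θxy , E.refl))
        where module E = IsEquivalence (IsCongruenceG.isEquivalence isCon)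

  module _ {ℓ} (φ : KCarrier G → KCarrier G → Set ℓ) (isCon : IsCongruenceK G φ) where
    private
      module C = IsCongruenceK isCon
      module E = IsEquivalence C.isEquivalence

    restrict : Carrier → Carrier → Set ℓ
    restrict x y = φ ⟨ x ,𝟎⟩ ⟨ y ,𝟎⟩

    restrict-isCongruenceG : IsCongruenceG G restrict
    restrict-isCongruenceG = record
      { isEquivalence = record { refl = E.refl ; sym = E.sym ; trans = E.trans }
      ; ∨-cong = λ p q → C.∨-cong p q (snd≡ (sym (∧-zero 𝟎))) (snd≡ (sym (∧-zero 𝟎)))
      ; ∧-cong = λ p q → C.∧-cong p q (snd≡ (sym (∨-identityʳ 𝟎))) (snd≡ (sym (∨-identityʳ 𝟎)))
      ; ⇒-cong = λ {x} {x′} p q → C.→-cong p q (snd≡ (sym (∧-zero x))) (snd≡ (sym (∧-zero x′)))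
      ; ∀-cong = ∀-cong
      ; ∃-cong = λ p → C.∃-cong p (snd≡ (sym ∀-zero)) (snd≡ (sym ∀-zero))
      }
      where
        snd≡ : ∀ {x y y′ : Carrier} → y ≡ y′ → (x , y) ≡ (x , y′)
        snd≡ = cong (_ ,_)

        ∀-cong : ∀ {x x′} → restrict x x′ → restrict (∀′ x) (∀′ x′)
        ∀-cong {x} {x′} p = C.∼-cong ∃∼p refl refl
          where
            ∼p : φ ⟨𝟎, x ⟩ ⟨𝟎, x′ ⟩
            ∼p = C.∼-cong p refl refl
            ∃∼p : φ ⟨𝟎, ∀′ x ⟩ ⟨𝟎, ∀′ x′ ⟩
            ∃∼p = C.∃-cong ∼p (cong (_, _) (sym M6)) (cong (_, _) (sym M6))

    ⊆₂-γ-restrict : φ ⊆₂ γ G restrict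
    ⊆₂-γ-restrict {(x , y) , e} {(x′ , y′) , e′} p =
        C.∨-cong p (E.refl {⟨ 𝟎 ,𝟎⟩}) (sym (∨K-⟨𝟎,𝟎⟩ x y)) (sym (∨K-⟨𝟎,𝟎⟩ x′ y′))
      , C.∨-cong (C.∼-cong {r = ∼⟨ e ⟩} {r′ = ∼⟨ e′ ⟩} p refl refl)
                 (E.refl {⟨ 𝟎 ,𝟎⟩}) (sym (∨K-⟨𝟎,𝟎⟩ y x)) (sym (∨K-⟨𝟎,𝟎⟩ y′ x′))

    γ-restrict-⊆₂ : γ G restrict ⊆₂ φ
    γ-restrict-⊆₂ {(x , y) , e} {(x′ , y′) , e′} (θxx′ , θyy′) =
      C.∧-cong θxx′ ¬θyy′ (K-decomposition e) (K-decomposition e′)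
      where
        ¬θyy′ : φ ¬K⟨ y ,𝟎⟩ ¬K⟨ y′ ,𝟎⟩
        ¬θyy′ = C.→-cong θyy′ (E.refl {⟨𝟎, 𝟏 ⟩}) (sym (→K-⟨𝟎,𝟏⟩ y)) (sym (→K-⟨𝟎,𝟏⟩ y′))

theorem4 : {a ℓ : Level} (G : MonadicGodelAlgebra a) →
    let open MonadicGodelAlgebra G in
    ((θ : Carrier → Carrier → Set ℓ) → IsCongruenceG G θ → IsCongruenceK G (γ G θ))
    × ((θ θ′ : Carrier → Carrier → Set ℓ) → IsCongruenceG G θ → IsCongruenceG G θ′ →
        (θ ⊆₂ θ′) ⇔ (γ G θ ⊆₂ γ G θ′))
    × ((φ : KCarrier G → KCarrier G → Set ℓ) → IsCongruenceK G φ →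
        Σ (Carrier → Carrier → Set ℓ) (λ θ → IsCongruenceG G θ × (φ ≐₂ γ G θ)))
theorem4 G =
    γ-isCongruenceK G
  , (λ θ θ′ isCon _ → γ-⊆₂⇔ G θ θ′ isCon)
  , λ φ isCon → restrict G φ isCon
              , restrict-isCongruenceG G φ isCon
              , ⊆₂-γ-restrict G φ isCon
              , γ-restrict-⊆₂ G φ isCon
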